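{- Let $k,m$ be positive integers and let $\mathcal P=\{P_1,\dots,P_k\}$ be patterns with $m_i=|P_i|\ge 2k\log m$. For each $i$ and $j\ge0$ let $P_{i,j}$ be the prefix of $P_i$ of length $2^j$ and $\rho_{i,j}$ its period. Let $D_1$ be the set containing, for each $i$, the longest $P_{i,j}$ with $\rho_{i,j}<k\log m$ and $2k\log m\le|P_{i,j}|\le m_i-2k\log m$, if such exists. Let $P_{i,j},P_{i',j'},P_{i'',j''}\in D_1$ and suppose that $P_{i,j}$ is a suffix of $P_{i',j'}$ and also a suffix of $P_{i'',j''}$. Then $P_{i',j'}$ is a suffix of $P_{i'',j''}$ or $P_{i'',j''}$ is a suffix of $P_{i',j'}$.
   Context: An integer $p$ with $0<p\le|x|$ is a period of a nonempty string $x$ if $x_i=x_{i+p}$ for all valid $i$; "the period" of $x$ means its smallest period. Logarithms are base 2, rounded to the nearest integer. -}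

module Defs where

open import Data.Nat using (ℕ; zero; suc; _+_; _*_; _∸_; _^_; _≤_; _<_; _/_)
open import Data.Nat.Logarithm using (⌊log₂_⌋)
open import Data.List using (List; length; take; drop; head)
open import Data.Fin using (Fin)
open import Data.Product using (Σ; _×_; ∃)
open import Relation.Binary.PropositionalEquality using (_≡_)
import Data.List.Relation.Binary.Suffix.Heterogeneous as SufH

IsSuffix : ∀ {A : Set} → List A → List A → Set
IsSuffix = SufH.Suffix _≡_

-- log₂ m rounded to the nearest integer (for m ≥ 1):
-- round(log₂ m) = ⌊(⌊log₂ (m²)⌋ + 1) / 2⌋  (ties cannot occur for integer m)
logR : ℕ → ℕ
logR m = (⌊log₂ (m * m) ⌋ + 1) / 2

IsPeriod : ∀ {A : Set} → List A → ℕ → Set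
IsPeriod x p = (0 < p) × (p ≤ length x) ×
  (∀ i → i + p < length x → head (drop i x) ≡ head (drop (i + p) x))

IsThePeriod : ∀ {A : Set} → List A → ℕ → Set
IsThePeriod x p = IsPeriod x p × (∀ q → IsPeriod x q → p ≤ q)

prefixPow : ∀ {A : Set} → List A → ℕ → List A
prefixPow P j = take (2 ^ j) P

module _ {A : Set} (k m : ℕ) (P : Fin k → List A) where

  Candidate : Fin k → ℕ → Set
  Candidate i j = (2 ^ j ≤ length (P i)) ×
    (∃ λ ρ → IsThePeriod (prefixPow (P i) j) ρ × ρ < k * logR m) ×
    (2 * k * logR m ≤ 2 ^ j) × (2 ^ j ≤ length (P i) ∸ 2 * k * logR m)

  Selected : Fin k → ℕ → Set
  Selected i j = Candidate i j × (∀ j' → Candidate i j' → j' ≤ j)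

  InD₁ : List A → Set
  InD₁ x = Σ (Fin k) λ i → Σ ℕ λ j → Selected i j × (x ≡ prefixPow (P i) j)

module Submission where

-- Every element of D₁ is a string w with a period ρ < k·log m
-- and length |w| ≥ 2k·log m.  So if x ∈ D₁ is a common suffix of y, z ∈ D₁,
-- with y of period q and z of period r, then q + r ≤ |x|.  The corollary is
-- thus an instance of a purely combinatorial fact:
--
--   if y has period q, z has period r, and they share a suffix x with
--   q + r ≤ |x|, then the shorter of y, z is a suffix of the longer.
--
-- Aligning y and z at their right ends (offset o = |z| - |y|), the two
-- strings agree on the positions of x.  Agreement propagates leftwards:
-- position i is linked to positions i+q, i+q+r, i+r further right through
-- the two periods (`aligned-everywhere`), and agreement at every position
-- of y is exactly the statement that y is a suffix of z.

open import Data.Nat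
open import Data.Nat.Properties
open import Data.Nat.Tactic.RingSolver using (solve-∀)
open import Data.List using (List; []; _∷_; _++_; length; drop; take; head)
open import Data.List.Properties using (length-++; drop-drop; length-drop; length-take; take++drop≡id)
import Data.List.Relation.Binary.Suffix.Heterogeneous as Suffix
open import Data.List.Relation.Binary.Pointwise using (Pointwise-≡⇒≡; ≡⇒Pointwise-≡)
open import Data.Maybe using (Maybe)
open import Data.Fin using (Fin)
open import Data.Product using (Σ; ∃; _×_; _,_)
open import Data.Sum using (_⊎_; inj₁; inj₂)
open import Data.Empty using (⊥-elim)
open import Relation.Binary.PropositionalEquality
open import Relation.Nullary using (yes; no)
open import Defs

at : ∀ {A : Set} → List A → ℕ → Maybe A
at w i = head (drop i w)

at-++ : ∀ {A : Set} (u w : List A) (j : ℕ) → at (u ++ w) (length u + j) ≡ at w j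
at-++ []      w j = refl
at-++ (a ∷ u) w j = at-++ u w j

at-ext : ∀ {A : Set} (y w : List A) → length y ≡ length w
       → (∀ i → i < length y → at y i ≡ at w i) → y ≡ w
at-ext []      []      _   _     = refl
at-ext (a ∷ y) (b ∷ w) len same with same 0 (s≤s z≤n)
... | refl = cong (a ∷_) (at-ext y w (suc-injective len) (λ i i< → same (suc i) (s≤s i<)))

Periodic : ∀ {A : Set} → List A → ℕ → Set
Periodic w q = ∀ i → i + q < length w → at w i ≡ at w (i + q)

AgreeAt : ∀ {A : Set} → List A → List A → ℕ → ℕ → Set
AgreeAt y z o i = at y i ≡ at z (i + o)

private
  swap-last : ∀ a b c → a + b + c ≡ a + c + b
  swap-last = solve-∀

  double : ∀ a b → 2 * a * b ≡ a * b + a * b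
  double = solve-∀

suffix⇒split : ∀ {A : Set} {y z : List A} → IsSuffix y z → ∃ λ w → z ≡ w ++ y
suffix⇒split s with Suffix.toView s
... | w Suffix.++ eq = w , cong (w ++_) (sym (Pointwise-≡⇒≡ eq))

split⇒suffix : ∀ {A : Set} {y z : List A} (w : List A) → z ≡ w ++ y → IsSuffix y z
split⇒suffix w refl = Suffix.fromView (w Suffix.++ ≡⇒Pointwise-≡ refl)

aligned⇒suffix : ∀ {A : Set} (y z : List A) (o : ℕ) → length z ≡ length y + o
               → (∀ i → i < length y → AgreeAt y z o i) → IsSuffix y z
aligned⇒suffix y z o len agree =
  split⇒suffix (take o z) (trans (sym (take++drop≡id o z)) (cong (take o z ++_) (sym y≡drop)))
  where
    y≡drop : y ≡ drop o z
    y≡drop = at-ext y (drop o z)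
      (sym (trans (length-drop o z) (trans (cong (_∸ o) len) (m+n∸n≡m (length y) o))))
      (λ i i< → trans (agree i i<) (trans (cong (at z) (+-comm i o)) (cong head (sym (drop-drop o i z)))))

common-suffix-agrees : ∀ {A : Set} (u v x : List A) (o : ℕ) → length v ≡ length u + o
                     → ∀ i → length u ≤ i → AgreeAt (u ++ x) (v ++ x) o i
common-suffix-agrees u v x o lv i u≤i with m≤n⇒∃[o]m+o≡n u≤i
... | j , refl = begin
  at (u ++ x) (length u + j)      ≡⟨ at-++ u x j ⟩
  at x j                          ≡⟨ at-++ v x j ⟨
  at (v ++ x) (length v + j)      ≡⟨ cong (λ n → at (v ++ x) (n + j)) lv ⟩
  at (v ++ x) (length u + o + j)  ≡⟨ cong (at (v ++ x)) (swap-last (length u) o j) ⟩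
  at (v ++ x) (length u + j + o)  ∎
  where open ≡-Reasoning

module Propagation {A : Set} (y z : List A) (o q r t : ℕ)
  (q>0 : 0 < q) (r>0 : 0 < r) (per-y : Periodic y q) (per-z : Periodic z r)
  (len : length z ≡ length y + o) (room : t + q + r ≤ length y)
  (agree-right : ∀ i → t ≤ i → i < length y → AgreeAt y z o i) where

  shift : ∀ {i} → i < length y → i + o < length z
  shift {i} i< = subst (i + o <_) (sym len) (+-monoˡ-< o i<)

  +q-inside : ∀ {i} → i + q + r < length y → i + q < length y
  +q-inside {i} = ≤-<-trans (m≤m+n (i + q) r)

  +r-inside : ∀ {i} → i + q + r < length y → i + r < length y
  +r-inside {i} = ≤-<-trans (subst (i + r ≤_) (swap-last i r q) (m≤m+n (i + r) q))

  step : ∀ i → i + q + r < length y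
       → AgreeAt y z o (i + q) → AgreeAt y z o (i + q + r) → AgreeAt y z o (i + r)
       → AgreeAt y z o i
  step i iqr< at-q at-qr at-r = begin
    at y i                ≡⟨ per-y i iq< ⟩
    at y (i + q)          ≡⟨ at-q ⟩
    at z (i + q + o)      ≡⟨ per-z (i + q + o) (subst (_< length z) (sym (swap-last (i + q) o r)) (shift iqr<)) ⟩
    at z (i + q + o + r)  ≡⟨ cong (at z) (swap-last (i + q) o r) ⟩
    at z (i + q + r + o)  ≡⟨ at-qr ⟨
    at y (i + q + r)      ≡⟨ cong (at y) (swap-last i q r) ⟩
    at y (i + r + q)      ≡⟨ per-y (i + r) (subst (_< length y) (swap-last i q r) iqr<) ⟨
    at y (i + r)          ≡⟨ at-r ⟩
    at z (i + r + o)      ≡⟨ cong (at z) (swap-last i r o) ⟩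
    at z (i + o + r)      ≡⟨ per-z (i + o) (subst (_< length z) (swap-last i r o) (shift ir<)) ⟨
    at z (i + o)          ∎
    where
      open ≡-Reasoning
      iq< : i + q < length y
      iq< = +q-inside iqr<
      ir< : i + r < length y
      ir< = +r-inside iqr<

  -- Induction on the fuel n bounding the distance |y| - i to the right end.
  agree-within : ∀ n i → length y ≤ i + n → i < length y → AgreeAt y z o i
  agree-within zero    i bound i< = ⊥-elim (<⇒≱ i< (subst (length y ≤_) (+-identityʳ i) bound))
  agree-within (suc n) i bound i< with t ≤? i
  ... | yes t≤i = agree-right i t≤i i<
  ... | no  t≰i = step i iqr< (recurse q q>0 (+q-inside iqr<)) at-qr (recurse r r>0 (+r-inside iqr<))
    where
      iqr< : i + q + r < length y
      iqr< = <-≤-trans (+-monoˡ-< r (+-monoˡ-< q (≰⇒> t≰i))) room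
      -- a position s > 0 further right is within fuel n
      recurse : ∀ s → 0 < s → i + s < length y → AgreeAt y z o (i + s)
      recurse s s>0 = agree-within n (i + s)
        (≤-trans bound (subst (i + suc n ≤_) (sym (+-assoc i s n)) (+-monoʳ-≤ i (+-monoˡ-≤ n s>0))))
      at-qr : AgreeAt y z o (i + q + r)
      at-qr = subst (AgreeAt y z o) (sym (+-assoc i q r))
        (recurse (q + r) (<-≤-trans q>0 (m≤m+n q r)) (subst (_< length y) (+-assoc i q r) iqr<))

  aligned-everywhere : ∀ i → i < length y → AgreeAt y z o i
  aligned-everywhere i = agree-within (length y) i (m≤n+m (length y) i)

periodic-common-suffix : ∀ {A : Set} (x y z : List A) (q r : ℕ) → 0 < q → 0 < r
  → Periodic y q → Periodic z r → q + r ≤ length x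
  → IsSuffix x y → IsSuffix x z → length y ≤ length z → IsSuffix y z
periodic-common-suffix x y z q r q>0 r>0 per-y per-z qr≤x x⊑y x⊑z y≤z
  with suffix⇒split x⊑y | suffix⇒split x⊑z
... | u , refl | v , refl = aligned⇒suffix y z o len P.aligned-everywhere
  where
    o = length z ∸ length y
    len : length z ≡ length y + o
    len = sym (m+[n∸m]≡n y≤z)
    lv : length v ≡ length u + o
    lv = +-cancelʳ-≡ (length x) (length v) (length u + o) (begin
      length v + length x        ≡⟨ length-++ v ⟨
      length z                   ≡⟨ len ⟩
      length y + o               ≡⟨ cong (_+ o) (length-++ u) ⟩
      length u + length x + o    ≡⟨ swap-last (length u) (length x) o ⟩
      length u + o + length x    ∎)
      where open ≡-Reasoning
    room : length u + q + r ≤ length y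
    room = subst₂ _≤_ (sym (+-assoc (length u) q r)) (sym (length-++ u)) (+-monoʳ-≤ (length u) qr≤x)
    module P = Propagation y z o q r (length u) q>0 r>0 per-y per-z len room
                 (λ i u≤i _ → common-suffix-agrees u v x o lv i u≤i)

periodic-suffixes-comparable : ∀ {A : Set} (x y z : List A) (q r : ℕ) → 0 < q → 0 < r
  → Periodic y q → Periodic z r → q + r ≤ length x
  → IsSuffix x y → IsSuffix x z → IsSuffix y z ⊎ IsSuffix z y
periodic-suffixes-comparable x y z q r q>0 r>0 per-y per-z qr≤x x⊑y x⊑z
  with ≤-total (length y) (length z)
... | inj₁ y≤z = inj₁ (periodic-common-suffix x y z q r q>0 r>0 per-y per-z qr≤x x⊑y x⊑z y≤z)
... | inj₂ z≤y = inj₂ (periodic-common-suffix x z y r q r>0 q>0 per-z per-y (subst (_≤ length x) (+-comm q r) qr≤x) x⊑z x⊑y z≤y)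

module _ {A : Set} (k m : ℕ) (P : Fin k → List A) where

  InD₁⇒periodic : ∀ {w} → InD₁ k m P w
    → Σ ℕ λ ρ → (0 < ρ) × Periodic w ρ × (ρ ≤ k * logR m)
  InD₁⇒periodic (_ , _ , ((_ , (ρ , ((ρ>0 , _ , per) , _) , ρ<) , _) , _) , refl) =
    ρ , ρ>0 , per , <⇒≤ ρ<

  InD₁⇒long : ∀ {w} → InD₁ k m P w → 2 * k * logR m ≤ length w
  InD₁⇒long (i , j , ((2ʲ≤ , _ , long , _) , _) , refl) =
    subst (2 * k * logR m ≤_) (sym (trans (length-take (2 ^ j) (P i)) (m≤n⇒m⊓n≡m 2ʲ≤))) long

corollary1 : {A : Set} (k m : ℕ) → 0 < k → 0 < m → (P : Fin k → List A)
    → (∀ i → 2 * k * logR m ≤ length (P i))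
    → (x y z : List A)
    → InD₁ k m P x → InD₁ k m P y → InD₁ k m P z
    → IsSuffix x y → IsSuffix x z
    → IsSuffix y z ⊎ IsSuffix z y
corollary1 k m _ _ P _ x y z x∈D₁ y∈D₁ z∈D₁ x⊑y x⊑z
  with InD₁⇒periodic k m P y∈D₁ | InD₁⇒periodic k m P z∈D₁
... | q , q>0 , per-y , q≤ | r , r>0 , per-z , r≤ =
  periodic-suffixes-comparable x y z q r q>0 r>0 per-y per-z qr≤x x⊑y x⊑z
  where
    -- q + r ≤ 2·k·log m ≤ |x|
    qr≤x : q + r ≤ length x
    qr≤x = ≤-trans (+-mono-≤ q≤ r≤)
      (subst (_≤ length x) (double k (logR m)) (InD₁⇒long k m P x∈D₁))
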